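{- Let $a,\delta$ be positive integers with $a<\delta<2a$, put $b=a+\delta$ and $S=\{a,b,a+b\}$. For $n\ge 0$ let $w_n = n + a\lfloor n/a\rfloor + b\lfloor n/\delta\rfloor$. Then for all integers $n>m\ge 0$, $w_n-w_m\notin S$. -}

module Defs where

open import Data.Nat using (ℕ; _+_; _*_; _/_; NonZero)

w : (a δ : ℕ) → .{{_ : NonZero a}} → .{{_ : NonZero δ}} → ℕ → ℕ
w a δ n = n + a * (n / a) + (a + δ) * (n / δ)

module Submission where

open import Defs
open import Data.Nat using (ℕ; zero; suc; _+_; _*_; _∸_; _/_; _%_; _≤_; _<_; NonZero; z≤n; s≤s)
open import Data.Nat.Properties
open import Data.Nat.DivMod using (m≡m%n+[m/n]*n; m%n<n; /-monoˡ-≤)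
open import Data.Nat.Tactic.RingSolver using (solve-∀)
open import Data.Product using (_×_; _,_; ∃-syntax)
open import Relation.Binary.Definitions using (tri<; tri≈; tri>)
open import Relation.Binary.PropositionalEquality using (_≡_; _≢_; refl; sym; trans; cong; cong₂; subst; module ≡-Reasoning)
open import Function using (_∘_)

-- Write n = m + d with d > 0.  Going from m to n raises ⌊·/a⌋ by some A with |d - A a| < a and
-- ⌊·/δ⌋ by some D with d < (D + 1) δ, so w_n - w_m = d + A a + D b.  If this lies in S then D ≤ 1,
-- and cancelling D b leaves d + A a ∈ {a, a + δ, 2a + δ}, with d < δ when D = 0.  Now |d - A a| < a
-- rules out d + A a = a, while d + A a = k a + δ with k ≥ 1 and d < δ forces A > k and then
-- 2a ≤ A a < δ, against δ < 2a.

/-increment : ∀ c .{{_ : NonZero c}} m d →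
              ∃[ A ] (m + d) / c ≡ m / c + A × A * c < d + c × d < suc A * c
/-increment c m d with m≤n⇒∃[o]m+o≡n (/-monoˡ-≤ c (m≤m+n m d))
... | A , m/c+A≡ = A , sym m/c+A≡ , A*c<d+c , d<[1+A]*c
  where
  open ≤-Reasoning
  -- both sides equal m + d - (m / c) * c
  remainders : (m + d) % c + A * c ≡ m % c + d
  remainders = +-cancelˡ-≡ (m / c * c) _ _ (begin-equality
    m / c * c + ((m + d) % c + A * c)  ≡⟨ shuffle c A (m / c) ((m + d) % c) ⟩
    (m + d) % c + (m / c + A) * c      ≡⟨ cong (λ q → (m + d) % c + q * c) m/c+A≡ ⟩
    (m + d) % c + (m + d) / c * c      ≡⟨ sym (m≡m%n+[m/n]*n (m + d) c) ⟩
    m + d                              ≡⟨ cong (_+ d) (m≡m%n+[m/n]*n m c) ⟩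
    m % c + m / c * c + d              ≡⟨ regroup (m % c) (m / c * c) d ⟩
    m / c * c + (m % c + d)            ∎)
    where
    shuffle : ∀ c A q r → q * c + (r + A * c) ≡ r + (q + A) * c
    shuffle = solve-∀
    regroup : ∀ x y z → x + y + z ≡ y + (x + z)
    regroup = solve-∀
  A*c<d+c : A * c < d + c
  A*c<d+c = begin-strict
    A * c                  ≤⟨ m≤n+m (A * c) _ ⟩
    (m + d) % c + A * c    ≡⟨ remainders ⟩
    m % c + d              <⟨ +-monoˡ-< d (m%n<n m c) ⟩
    c + d                  ≡⟨ +-comm c d ⟩
    d + c                  ∎
  d<[1+A]*c : d < suc A * c
  d<[1+A]*c = begin-strict
    d                      ≤⟨ m≤n+m d _ ⟩
    m % c + d              ≡⟨ remainders ⟨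
    (m + d) % c + A * c    <⟨ +-monoˡ-< (A * c) (m%n<n (m + d) c) ⟩
    suc A * c              ∎

w-increment : ∀ a δ .{{_ : NonZero a}} .{{_ : NonZero δ}} m d A D →
              (m + d) / a ≡ m / a + A → (m + d) / δ ≡ m / δ + D →
              w a δ (m + d) ≡ w a δ m + (d + A * a + D * (a + δ))
w-increment a δ m d A D eqA eqD = trans
  (cong₂ (λ x y → m + d + a * x + (a + δ) * y) eqA eqD)
  (regroup a δ m d (m / a) (m / δ) A D)
  where
  regroup : ∀ a δ m d p q A D → m + d + a * (p + A) + (a + δ) * (q + D)
                        ≡ m + a * p + (a + δ) * q + (d + A * a + D * (a + δ))
  regroup = solve-∀

m+n*o≢o : ∀ {m o} n → 0 < m → m < suc n * o → m + n * o ≢ o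
m+n*o≢o {m} {o} zero 0<m m<o eq =
  <-irrefl (trans (sym (+-identityʳ m)) eq) (subst (m <_) (+-identityʳ o) m<o)
m+n*o≢o {m} {o} (suc n) 0<m _ eq = <-irrefl refl (begin-strict
  o                    <⟨ m<n+m o 0<m ⟩
  m + o                ≤⟨ +-monoʳ-≤ m (m≤m+n o (n * o)) ⟩
  m + (o + n * o)      ≡⟨ eq ⟩
  o                    ∎)
  where open ≤-Reasoning

m+n*o≢[1+k]*o+p : ∀ {m o p} n k → p < 2 * o → m < p → n * o < m + o →
                  m + n * o ≢ suc k * o + p
m+n*o≢[1+k]*o+p {m} {o} {p} n k p<2o m<p n*o<m+o eq with <-cmp n (suc k)
... | tri< n<1+k _ _ = <⇒≱ m<p (≤-trans (m≤n+m p o) o+p≤m)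
  where
  open ≤-Reasoning
  o+p≤m : o + p ≤ m
  o+p≤m = +-cancelˡ-≤ (n * o) _ _ (begin
    n * o + (o + p)    ≡⟨ +-assoc (n * o) o p ⟨
    n * o + o + p      ≡⟨ cong (_+ p) (+-comm (n * o) o) ⟩
    suc n * o + p      ≤⟨ +-monoˡ-≤ p (*-monoˡ-≤ o n<1+k) ⟩
    suc k * o + p      ≡⟨ eq ⟨
    m + n * o          ≡⟨ +-comm m (n * o) ⟩
    n * o + m          ∎)
... | tri≈ _ refl _ = <-irrefl (+-cancelˡ-≡ (suc k * o) _ _ (trans (+-comm (suc k * o) m) eq)) m<p
... | tri> _ _ 1+k<n = <-irrefl refl (begin-strict
  2 * o              ≤⟨ *-monoˡ-≤ o (s≤s (s≤s (z≤n {k}))) ⟩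
  suc (suc k) * o    ≤⟨ *-monoˡ-≤ o 1+k<n ⟩
  n * o              <⟨ n*o<p ⟩
  p                  <⟨ p<2o ⟩
  2 * o              ∎)
  where
  open ≤-Reasoning
  n*o<p : n * o < p
  n*o<p = +-cancelˡ-< (o + suc k * o) _ _ (begin-strict
    (o + suc k * o) + n * o    ≤⟨ +-monoˡ-≤ (n * o) (*-monoˡ-≤ o 1+k<n) ⟩
    n * o + n * o              <⟨ +-monoˡ-< (n * o) n*o<m+o ⟩
    m + o + n * o              ≡⟨ regroup m o (n * o) ⟩
    o + (m + n * o)            ≡⟨ cong (o +_) eq ⟩
    o + (suc k * o + p)        ≡⟨ +-assoc o (suc k * o) p ⟨
    (o + suc k * o) + p        ∎)
    where
    regroup : ∀ x o y → x + o + y ≡ o + (x + y)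
    regroup = solve-∀

0<m∧p≤o⇒m+n+o≢p : ∀ {m} n {o p} → 0 < m → p ≤ o → m + n + o ≢ p
0<m∧p≤o⇒m+n+o≢p {m} n {o} 0<m p≤o eq =
  <⇒≱ (subst (o <_) eq (m<n+m o (≤-trans 0<m (m≤m+n m n)))) p≤o

increment≢a : ∀ a δ {d} A D → 0 < d → d < suc A * a →
              d + A * a + D * (a + δ) ≢ a
increment≢a a δ {d} A zero 0<d d<[1+A]*a eq =
  m+n*o≢o A 0<d d<[1+A]*a (trans (sym (+-identityʳ (d + A * a))) eq)
increment≢a a δ A (suc D) 0<d _ =
  0<m∧p≤o⇒m+n+o≢p (A * a) 0<d (≤-trans (m≤m+n a δ) (m≤m+n (a + δ) (D * (a + δ))))

increment≢b : ∀ a δ {d} A D → δ < 2 * a → 0 < d → A * a < d + a → d < suc D * δ →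
              d + A * a + D * (a + δ) ≢ a + δ
increment≢b a δ {d} A zero δ<2a _ A*a<d+a d<δ+0 eq =
  m+n*o≢[1+k]*o+p A 0 δ<2a (subst (d <_) (+-identityʳ δ) d<δ+0) A*a<d+a (begin
    d + A * a          ≡⟨ +-identityʳ (d + A * a) ⟨
    d + A * a + 0      ≡⟨ eq ⟩
    a + δ              ≡⟨ cong (_+ δ) (+-identityʳ a) ⟨
    (a + 0) + δ        ∎)
  where open ≡-Reasoning
increment≢b a δ A (suc D) _ 0<d _ _ =
  0<m∧p≤o⇒m+n+o≢p (A * a) 0<d (m≤m+n (a + δ) (D * (a + δ)))

increment≢a+b : ∀ a δ {d} A D → δ < 2 * a → 0 < d → A * a < d + a → d < suc A * a → d < suc D * δ →
                d + A * a + D * (a + δ) ≢ a + (a + δ)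
increment≢a+b a δ {d} A zero δ<2a _ A*a<d+a _ d<δ+0 eq =
  m+n*o≢[1+k]*o+p A 1 δ<2a (subst (d <_) (+-identityʳ δ) d<δ+0) A*a<d+a (begin
    d + A * a          ≡⟨ +-identityʳ (d + A * a) ⟨
    d + A * a + 0      ≡⟨ eq ⟩
    a + (a + δ)        ≡⟨ regroup a δ ⟩
    (a + (a + 0)) + δ  ∎)
  where
  open ≡-Reasoning
  regroup : ∀ a δ → a + (a + δ) ≡ (a + (a + 0)) + δ
  regroup = solve-∀
increment≢a+b a δ {d} A (suc zero) _ 0<d _ d<[1+A]*a _ eq =
  m+n*o≢o A 0<d d<[1+A]*a (+-cancelʳ-≡ (a + δ) _ _ (begin
    d + A * a + (a + δ)      ≡⟨ cong (d + A * a +_) (+-identityʳ (a + δ)) ⟨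
    d + A * a + (a + δ + 0)  ≡⟨ eq ⟩
    a + (a + δ)              ∎))
  where open ≡-Reasoning
increment≢a+b a δ A (suc (suc D)) _ 0<d _ _ _ =
  0<m∧p≤o⇒m+n+o≢p (A * a) 0<d (+-mono-≤ (m≤m+n a δ) (m≤m+n (a + δ) (D * (a + δ))))

GapNotInS : ∀ a δ .{{_ : NonZero a}} .{{_ : NonZero δ}} → ℕ → ℕ → Set
GapNotInS a δ m n =
  (w a δ n ≢ w a δ m + a) × (w a δ n ≢ w a δ m + (a + δ)) × (w a δ n ≢ w a δ m + (a + (a + δ)))

w-gap∉S : ∀ a δ .{{_ : NonZero a}} .{{_ : NonZero δ}} → δ < 2 * a →
          ∀ m d → 0 < d → GapNotInS a δ m (m + d)
w-gap∉S a δ δ<2a m d 0<d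
  with A , eqA , A*a<d+a , d<[1+A]*a ← /-increment a m d
     | D , eqD , _ , d<[1+D]*δ ← /-increment δ m d =
  increment≢a a δ A D 0<d d<[1+A]*a ∘ jump ,
  increment≢b a δ A D δ<2a 0<d A*a<d+a d<[1+D]*δ ∘ jump ,
  increment≢a+b a δ A D δ<2a 0<d A*a<d+a d<[1+A]*a d<[1+D]*δ ∘ jump
  where
  jump : ∀ {s} → w a δ (m + d) ≡ w a δ m + s → d + A * a + D * (a + δ) ≡ s
  jump eq = +-cancelˡ-≡ (w a δ m) _ _ (trans (sym (w-increment a δ m d A D eqA eqD)) eq)

lemma2p1 : (a δ : ℕ) → .{{_ : NonZero a}} → .{{_ : NonZero δ}} →
             a < δ → δ < 2 * a →
             (m n : ℕ) → m < n →
             (w a δ n ≢ w a δ m + a) × (w a δ n ≢ w a δ m + (a + δ)) × (w a δ n ≢ w a δ m + (a + (a + δ)))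
lemma2p1 a δ _ δ<2a m n m<n =
  subst (GapNotInS a δ m) (m+[n∸m]≡n (<⇒≤ m<n)) (w-gap∉S a δ δ<2a m (n ∸ m) (m<n⇒0<n∸m m<n))
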